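{- Let $(S,\mathcal{R})$ be an instance of the minimum axiom set problem, and let $\mu\colon S\to\mathbb{Z}$ be a non-negative function; for $U\subseteq S$ put $\mu(U)=\sum_{s\in U}\mu(s)$. Assume that $\mu(U)\ge 1$ for every $U\subseteq S$ such that $S\setminus U$ is not an axiom set. Then $\mu(S)\ge k^*$, where $k^*$ is the size of a minimum axiom set of $(S,\mathcal{R})$.
   Context: An instance of the minimum axiom set problem is a finite set $S$ (of sentences) together with a finite set $\mathcal{R}$ of relations, i.e. pairs $(T,t)$ with $T\subseteq S$ and $t\in S$. For $S_0\subseteq S$, define inductively $S_i$ as the union of $S_{i-1}$ and all $t\in S$ for which there is $T\subseteq S_{i-1}$ with $(T,t)\in\mathcal{R}$; the consequences of $S_0$ are $c(S_0)=\bigcup_{i\ge 1}S_i$. A set $A\subseteq S$ is an axiom set if $c(A)=S$. -}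

module Defs where

open import Data.Nat using (ℕ; zero; suc)
open import Data.Fin using (Fin)
open import Data.Fin.Subset using (Subset; _∈_; ∁; ∣_∣; ⊤)
open import Data.Integer using (ℤ; 0ℤ; 1ℤ; _+_; _≤_; +_)
open import Data.Bool using (if_then_else_)
open import Data.Vec using (lookup)
open import Data.List using (List; foldr; map)
open import Data.List.Base using (allFin)
open import Data.List.Membership.Propositional renaming (_∈_ to _∈ₗ_)
open import Data.Product using (_×_; _,_; Σ; ∃; ∃-syntax)
open import Data.Sum using (_⊎_)
open import Relation.Binary.PropositionalEquality using (_≡_)

-- An instance of the minimum axiom set problem: S = Fin n (a finite set of
-- sentences), and a finite list of relations (T , t) with T ⊆ S and t ∈ S.
Relations : ℕ → Set
Relations n = List (Subset n × Fin n)

Stage : (n : ℕ) → Relations n → Subset n → ℕ → Fin n → Set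
Stage n R A zero s = s ∈ A
Stage n R A (suc i) s =
  Stage n R A i s ⊎
  (∃[ T ] (((T , s) ∈ₗ R) × (∀ x → x ∈ T → Stage n R A i x)))

Consequence : (n : ℕ) → Relations n → Subset n → Fin n → Set
Consequence n R A s = ∃[ i ] Stage n R A (suc i) s

IsAxiomSet : (n : ℕ) → Relations n → Subset n → Set
IsAxiomSet n R A = ∀ s → Consequence n R A s

IsMinimumAxiomSet : (n : ℕ) → Relations n → Subset n → Set
IsMinimumAxiomSet n R A =
  IsAxiomSet n R A × (∀ B → IsAxiomSet n R B → Data.Nat._≤_ ∣ A ∣ ∣ B ∣)
  where import Data.Nat

weight : {n : ℕ} → (Fin n → ℤ) → Subset n → ℤ
weight {n} μ U =
  foldr _+_ 0ℤ (map (λ s → if lookup U s then μ s else 0ℤ) (allFin n))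

-- Let Z be the set of sentences of weight zero. Since μ(Z) = 0, the hypothesis
-- forces S ∖ Z to be an axiom set, so k* ≤ |S ∖ Z|; and every sentence outside
-- Z has weight at least 1, so |S ∖ Z| ≤ μ(S). The conclusion is a decidable
-- inequality, so the double negation coming from the hypothesis can be dropped.
module Submission where

open import Defs
open import Data.Nat using (ℕ; zero; suc; s≤s; z≤n)
open import Data.Fin using (Fin)
open import Data.Fin.Subset using (Subset; ∁; ∣_∣; ⊤)
open import Data.Integer using (ℤ; 0ℤ; 1ℤ; _≤_; +_; -[1+_]; _+_; +≤+; _≤?_)
open import Data.Integer.Properties using (≤-trans; +-mono-≤; +-identityˡ)
open import Data.Bool using (Bool; true; false; if_then_else_)
open import Data.Vec using (_∷_; tabulate; lookup)
open import Data.List using (foldr; map)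
open import Data.List.Properties using (map-tabulate)
open import Data.Product using (_,_)
open import Function using (_∘_)
open import Relation.Nullary using (¬_)
open import Relation.Nullary.Decidable using (decidable-stable)
open import Relation.Binary.PropositionalEquality using (_≡_; refl; cong; cong₂; subst; trans; sym)

isZero : ℤ → Bool
isZero (+ zero) = true
isZero _        = false

zeros : {n : ℕ} → (Fin n → ℤ) → Subset n
zeros μ = tabulate (isZero ∘ μ)

weight-∷ : ∀ {n} (μ : Fin (suc n) → ℤ) b (U : Subset n) →
  weight μ (b ∷ U) ≡ (if b then μ Fin.zero else 0ℤ) + weight (μ ∘ Fin.suc) U
weight-∷ {n} μ b U = trans
  (cong (foldr _+_ 0ℤ) (map-tabulate (λ s → s) summand))
  (cong (_+_ (if b then μ Fin.zero else 0ℤ))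
        (sym (cong (foldr _+_ 0ℤ) (map-tabulate (λ s → s) (summand ∘ Fin.suc)))))
  where
  summand : Fin (suc n) → ℤ
  summand s = if lookup (b ∷ U) s then μ s else 0ℤ

weight-zeros : ∀ {n} (μ : Fin n → ℤ) → weight μ (zeros μ) ≡ 0ℤ
weight-zeros {zero}  μ = refl
weight-zeros {suc n} μ = trans (weight-∷ μ (isZero (μ Fin.zero)) (zeros (μ ∘ Fin.suc)))
  (cong₂ _+_ (vanishes (μ Fin.zero)) (weight-zeros (μ ∘ Fin.suc)))
  where
  vanishes : (z : ℤ) → (if isZero z then z else 0ℤ) ≡ 0ℤ
  vanishes (+ zero)  = refl
  vanishes (+ suc _) = refl
  vanishes -[1+ _ ]  = refl

∣∁zeros∣≤weight : ∀ {n} (μ : Fin n → ℤ) → (∀ s → 0ℤ ≤ μ s) →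
  + ∣ ∁ (zeros μ) ∣ ≤ weight μ ⊤
∣∁zeros∣≤weight {zero}  μ μ≥0 = +≤+ z≤n
∣∁zeros∣≤weight {suc n} μ μ≥0
  rewrite weight-∷ μ true ⊤
  with μ Fin.zero | μ≥0 Fin.zero | ∣∁zeros∣≤weight (μ ∘ Fin.suc) (μ≥0 ∘ Fin.suc)
... | + zero  | _ | ih = subst (+ ∣ ∁ (zeros (μ ∘ Fin.suc)) ∣ ≤_) (sym (+-identityˡ _)) ih
... | + suc _ | _ | ih = +-mono-≤ (+≤+ (s≤s z≤n)) ih
... | -[1+ _ ] | () | _

lemma15 : (n : ℕ) (R : Relations n) (μ : Fin n → ℤ) →
    (∀ s → 0ℤ ≤ μ s) →
    (∀ (U : Subset n) → ¬ IsAxiomSet n R (∁ U) → 1ℤ ≤ weight μ U) →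
    ∀ (A : Subset n) → IsMinimumAxiomSet n R A →
    + ∣ A ∣ ≤ weight μ ⊤
lemma15 n R μ μ≥0 heavy A (_ , minimum) = decidable-stable (_ ≤? _) λ ¬goal →
  ¬¬∁zeros-isAxiomSet λ ∁zeros-isAxiomSet →
    ¬goal (≤-trans (+≤+ (minimum _ ∁zeros-isAxiomSet)) (∣∁zeros∣≤weight μ μ≥0))
  where
  ¬¬∁zeros-isAxiomSet : ¬ ¬ IsAxiomSet n R (∁ (zeros μ))
  ¬¬∁zeros-isAxiomSet ¬axioms with subst (1ℤ ≤_) (weight-zeros μ) (heavy (zeros μ) ¬axioms)
  ... | +≤+ ()
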